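{- Let $n$ be a positive integer and let $f(x)=x^3+bx+a^n$, where $a,b$ are co-prime integers with $a>0$ and $b\neq 0$. If $\mathbb{Q}$ is a splitting field for $f(x)$, then there exist positive integers $p,q,r$ such that $a=pqr$ and $(X,Y,Z)=(p,q,r)$ is a solution of the equation $X^n+Y^n=Z^n$ with $X,Y,Z$ pairwise co-prime. Conversely, if there exist positive integers $p,q,r$ which are a solution $(X,Y,Z)=(p,q,r)$ of $X^n+Y^n=Z^n$ with $X,Y,Z$ pairwise co-prime, then there exists a polynomial $f(x)=x^3+bx+a^n$ with $a=pqr$, an integer $b\neq 0$ and $\gcd(a,b)=1$, such that $\mathbb{Q}$ is its splitting field.
   Context: "$\mathbb{Q}$ is a splitting field for $f(x)$" means that $f(x)$ factors as a product of linear factors over $\mathbb{Q}$. -}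

module Defs where

open import Data.List using (List; []; _∷_; map)
open import Data.Product using (Σ; ∃; _×_)
open import Relation.Binary.PropositionalEquality using (_≡_)
open import Data.Integer as ℤ using (ℤ)
open import Data.Rational as ℚ using (ℚ; 0ℚ; 1ℚ)

-- Polynomials over ℚ as coefficient lists, lowest degree first.
Polyℚ : Set
Polyℚ = List ℚ

infixl 6 _+ₚ_
infixl 7 _*ₚ_

_+ₚ_ : Polyℚ → Polyℚ → Polyℚ
[] +ₚ q = q
(x ∷ p) +ₚ [] = x ∷ p
(x ∷ p) +ₚ (y ∷ q) = (x ℚ.+ y) ∷ (p +ₚ q)

scaleₚ : ℚ → Polyℚ → Polyℚ
scaleₚ c p = map (c ℚ.*_) p

_*ₚ_ : Polyℚ → Polyℚ → Polyℚ
[] *ₚ q = []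
(x ∷ p) *ₚ q = scaleₚ x q +ₚ (0ℚ ∷ (p *ₚ q))

linear : ℚ → Polyℚ
linear r = ℚ.- r ∷ 1ℚ ∷ []

prodLinear : List ℚ → Polyℚ
prodLinear [] = 1ℚ ∷ []
prodLinear (r ∷ rs) = linear r *ₚ prodLinear rs

ℤtoℚ : ℤ → ℚ
ℤtoℚ z = z ℚ./ 1

cubic : ℤ → ℤ → Polyℚ
cubic b c = ℤtoℚ c ∷ ℤtoℚ b ∷ 0ℚ ∷ 1ℚ ∷ []

-- "ℚ is a splitting field for f": f factors over ℚ as a product of linear factors,
-- i.e. f = c · ∏ (x - rᵢ) with c, rᵢ ∈ ℚ.
SplitsOverℚ : Polyℚ → Set
SplitsOverℚ f = Σ ℚ λ c → Σ (List ℚ) λ rs → f ≡ scaleₚ c (prodLinear rs)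

module Submission where

-- If X³ + bX + aⁿ splits over ℚ, its roots are integers (it is monic with integer coefficients);
-- they sum to 0 and multiply to -aⁿ < 0, so they are u, v, -(u + v) with u, v > 0, and then
-- b = -(u² + uv + v²) and uv(u + v) = aⁿ. As gcd(a, b) = 1, the factors u, v, u + v are pairwise
-- coprime, so each is an n-th power of its gcd with a: u = pⁿ, v = qⁿ, u + v = rⁿ, whence
-- pⁿ + qⁿ = rⁿ and a = pqr. Conversely, pⁿ, qⁿ and -rⁿ are the roots of X³ - (P² + PQ + Q²)X + (pqr)ⁿ
-- where P = pⁿ, Q = qⁿ.

open import Defs
open import Algebra.Bundles using (CommutativeRing)
open import Data.Product using (_×_; _,_)

module PowersAndCoprimality where
  open import Data.Nat.Base using (ℕ; zero; suc; _+_; _*_; _^_; _<_; s≤s; z≤n)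
  open import Data.Nat.Properties
  open import Data.Nat.Divisibility
  open import Data.Nat.GCD using (gcd; gcd[m,n]∣m; gcd[m,n]∣n; gcd[m,n]≡0⇒m≡0; gcd[m,n]≡0⇒n≡0; c*gcd[m,n]≡gcd[cm,cn])
  open import Data.Nat.Coprimality as Coprimality
    using (Coprime; coprime⇒gcd≡1; gcd≡1⇒coprime; coprime-divisor; 1-coprimeTo; coprime-+)
  open import Data.Nat.Tactic.RingSolver using (solve-∀)
  open import Data.Empty using (⊥-elim)
  open import Relation.Binary.Definitions using (tri<; tri≈; tri>)
  open import Relation.Binary.PropositionalEquality
  open ≡-Reasoning

  coprime-*ˡ : ∀ {m n o} → Coprime m o → Coprime n o → Coprime (m * n) o
  coprime-*ˡ m⊥o n⊥o (d∣mn , d∣o) =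
    n⊥o (coprime-divisor (λ (e∣d , e∣m) → m⊥o (e∣m , ∣-trans e∣d d∣o)) d∣mn , d∣o)

  coprime-*ʳ : ∀ {m n o} → Coprime m n → Coprime m o → Coprime m (n * o)
  coprime-*ʳ m⊥n m⊥o = Coprimality.sym (coprime-*ˡ (Coprimality.sym m⊥n) (Coprimality.sym m⊥o))

  coprime-∣ : ∀ {m n m′ n′} → m′ ∣ m → n′ ∣ n → Coprime m n → Coprime m′ n′
  coprime-∣ m′∣m n′∣n m⊥n (d∣m′ , d∣n′) = m⊥n (∣-trans d∣m′ m′∣m , ∣-trans d∣n′ n′∣n)

  coprime-+ˡ : ∀ {u v} → Coprime u v → Coprime u (u + v)
  coprime-+ˡ u⊥v = Coprimality.sym (coprime-+ (Coprimality.sym u⊥v))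

  coprime-+ʳ : ∀ {u v} → Coprime u v → Coprime v (u + v)
  coprime-+ʳ {u} {v} u⊥v = Coprimality.sym (subst (λ s → Coprime s v) (+-comm v u) (coprime-+ u⊥v))

  coprime-^ˡ : ∀ {m o} k → Coprime m o → Coprime (m ^ k) o
  coprime-^ˡ {o = o} zero    _   = 1-coprimeTo o
  coprime-^ˡ         (suc k) m⊥o = coprime-*ˡ m⊥o (coprime-^ˡ k m⊥o)

  ∣⇒∣^ : ∀ {d m} k → d ∣ m → d ∣ m ^ suc k
  ∣⇒∣^ {m = m} k d∣m = ∣-trans d∣m (m∣m*n (m ^ k))

  coprime-^ˡ⁻¹ : ∀ {m o} k → Coprime (m ^ suc k) o → Coprime m o
  coprime-^ˡ⁻¹ k m^⊥o (d∣m , d∣o) = m^⊥o (∣⇒∣^ k d∣m , d∣o)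

  ^-distribʳ-* : ∀ m n k → (m * n) ^ k ≡ m ^ k * n ^ k
  ^-distribʳ-* m n zero    = refl
  ^-distribʳ-* m n (suc k) = begin
    m * n * (m * n) ^ k      ≡⟨ cong (m * n *_) (^-distribʳ-* m n k) ⟩
    m * n * (m ^ k * n ^ k)  ≡⟨ interchange m n (m ^ k) (n ^ k) ⟩
    m * m ^ k * (n * n ^ k)  ∎
    where
    interchange : ∀ a b c d → a * b * (c * d) ≡ a * c * (b * d)
    interchange = solve-∀

  ^-cancelʳ-≡ : ∀ {m n} k → m ^ suc k ≡ n ^ suc k → m ≡ n
  ^-cancelʳ-≡ {m} {n} k eq with <-cmp m n
  ... | tri< m<n _ _ = ⊥-elim (<-irrefl eq (^-monoˡ-< (suc k) m<n))
  ... | tri≈ _ m≡n _ = m≡n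
  ... | tri> _ _ n<m = ⊥-elim (<-irrefl (sym eq) (^-monoˡ-< (suc k) n<m))

  coprime-^ : ∀ {m n} j k → Coprime m n → Coprime (m ^ j) (n ^ k)
  coprime-^ j k m⊥n = Coprimality.sym (coprime-^ˡ k (Coprimality.sym (coprime-^ˡ j m⊥n)))

  gcd-^ : ∀ m n k → gcd m n ^ k ≡ gcd (m ^ k) (n ^ k)
  gcd-^ m n zero = refl
  gcd-^ m n (suc k) with gcd m n in gcd≡
  ... | zero = sym (cong₂ (λ a b → gcd (a ^ suc k) (b ^ suc k)) (gcd[m,n]≡0⇒m≡0 {m} {n} gcd≡) (gcd[m,n]≡0⇒n≡0 m {n} gcd≡))
  ... | g@(suc _) = sym (begin
    gcd (m ^ suc k) (n ^ suc k)
      ≡⟨ cong₂ (λ a b → gcd (a ^ suc k) (b ^ suc k)) (m∣n⇒n≡m*quotient g∣m) (m∣n⇒n≡m*quotient g∣n) ⟩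
    gcd ((g * m′) ^ suc k) ((g * n′) ^ suc k)
      ≡⟨ cong₂ gcd (^-distribʳ-* g m′ (suc k)) (^-distribʳ-* g n′ (suc k)) ⟩
    gcd (g ^ suc k * m′ ^ suc k) (g ^ suc k * n′ ^ suc k)
      ≡⟨ sym (c*gcd[m,n]≡gcd[cm,cn] (g ^ suc k) _ _) ⟩
    g ^ suc k * gcd (m′ ^ suc k) (n′ ^ suc k)
      ≡⟨ cong (g ^ suc k *_) (coprime⇒gcd≡1 (coprime-^ (suc k) (suc k) (gcd≡1⇒coprime {m′} {n′} cofactors-coprime))) ⟩
    g ^ suc k * 1
      ≡⟨ *-identityʳ _ ⟩
    g ^ suc k ∎)
    where
    g∣m : g ∣ m
    g∣m = subst (_∣ m) gcd≡ (gcd[m,n]∣m m n)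
    g∣n : g ∣ n
    g∣n = subst (_∣ n) gcd≡ (gcd[m,n]∣n m n)
    m′ n′ : ℕ
    m′ = quotient g∣m
    n′ = quotient g∣n
    cofactors-coprime : gcd m′ n′ ≡ 1
    cofactors-coprime = *-cancelˡ-≡ (gcd m′ n′) 1 g (begin
      g * gcd m′ n′         ≡⟨ c*gcd[m,n]≡gcd[cm,cn] g m′ n′ ⟩
      gcd (g * m′) (g * n′) ≡⟨ sym (cong₂ gcd (m∣n⇒n≡m*quotient g∣m) (m∣n⇒n≡m*quotient g∣n)) ⟩
      gcd m n               ≡⟨ gcd≡ ⟩
      g                     ≡⟨ sym (*-identityʳ g) ⟩
      g * 1                 ∎)

  coprime-factor-of-power : ∀ {m n o} k → Coprime m n → m * n ≡ o ^ suc k → m ≡ gcd m o ^ suc k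
  coprime-factor-of-power {m} {n} {o} k m⊥n mn≡o^ = sym (begin
    gcd m o ^ suc k             ≡⟨ gcd-^ m o (suc k) ⟩
    gcd (m * m ^ k) (o ^ suc k) ≡⟨ cong (gcd (m * m ^ k)) (sym mn≡o^) ⟩
    gcd (m * m ^ k) (m * n)     ≡⟨ sym (c*gcd[m,n]≡gcd[cm,cn] m (m ^ k) n) ⟩
    m * gcd (m ^ k) n           ≡⟨ cong (m *_) (coprime⇒gcd≡1 (coprime-^ˡ k m⊥n)) ⟩
    m * 1                       ≡⟨ *-identityʳ m ⟩
    m                           ∎)

  0<base : ∀ {m} k → 0 < m ^ suc k → 0 < m
  0<base {suc _} k _ = s≤s z≤n

  0<^ : ∀ {m} k → 0 < m → 0 < m ^ k
  0<^ {suc m} k _ = m^n>0 (suc m) k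

module FermatTriples where
  open import Data.Nat.Base using (ℕ; suc; _+_; _*_; _^_; _<_; s≤s; z≤n)
  open import Data.Nat.Coprimality as Coprimality using (Coprime)
  open import Data.Product using (Σ)
  open import Relation.Binary.PropositionalEquality
  open import Data.Nat.Properties using (*-comm; *-assoc; <-≤-trans; m≤m+n)
  open import Data.Nat.Divisibility using (_∣_; ∣m+n∣m⇒∣n; ∣m∣n⇒∣m+n; ∣m⇒∣m*n; ∣n⇒∣m*n)
  open import Data.Nat.GCD using (gcd; gcd[m,n]∣m)
  open import Data.Nat.Tactic.RingSolver using (solve-∀)
  open PowersAndCoprimality
  open ≡-Reasoning

  -- Minus the linear coefficient of (X - u)(X - v)(X + u + v).
  quadForm : ℕ → ℕ → ℕ
  quadForm u v = u * u + u * v + v * v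

  coprime⇒coprime-quadForm : ∀ {u v} → Coprime u v → Coprime (u * v * (u + v)) (quadForm u v)
  coprime⇒coprime-quadForm {u} {v} u⊥v = coprime-*ˡ (coprime-*ˡ u⊥Q v⊥Q) u+v⊥Q
    where
    u⊥Q : Coprime u (quadForm u v)
    u⊥Q {d} (d∣u , d∣Q) = Coprimality.sym (coprime-*ˡ (Coprimality.sym u⊥v) (Coprimality.sym u⊥v))
      (d∣u , ∣m+n∣m⇒∣n d∣Q (∣m∣n⇒∣m+n (∣m⇒∣m*n u d∣u) (∣m⇒∣m*n v d∣u)))
    v⊥Q : Coprime v (quadForm u v)
    v⊥Q {d} (d∣v , d∣Q) = Coprimality.sym (coprime-*ˡ u⊥v u⊥v)
      (d∣v , ∣m+n∣m⇒∣n (subst (d ∣_) (rearrange u v) d∣Q) (∣m∣n⇒∣m+n (∣n⇒∣m*n u d∣v) (∣m⇒∣m*n v d∣v)))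
      where
      rearrange : ∀ u v → u * u + u * v + v * v ≡ u * v + v * v + u * u
      rearrange = solve-∀
    u+v⊥uv : Coprime (u + v) (u * v)
    u+v⊥uv = coprime-*ʳ (Coprimality.sym (coprime-+ˡ u⊥v)) (Coprimality.sym (coprime-+ʳ u⊥v))
    u+v⊥Q : Coprime (u + v) (quadForm u v)
    u+v⊥Q {d} (d∣u+v , d∣Q) =
      u+v⊥uv (d∣u+v , ∣m+n∣m⇒∣n (subst (d ∣_) (square-sum u v) (∣m⇒∣m*n (u + v) d∣u+v)) d∣Q)
      where
      square-sum : ∀ u v → (u + v) * (u + v) ≡ (u * u + u * v + v * v) + u * v
      square-sum = solve-∀

  coprime-quadForm⇒coprime : ∀ {u v w} → Coprime (u * v * w) (quadForm u v) → Coprime u v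
  coprime-quadForm⇒coprime {u} {v} {w} uvw⊥Q (d∣u , d∣v) =
    uvw⊥Q (∣m⇒∣m*n w (∣m⇒∣m*n v d∣u) ,
           ∣m∣n⇒∣m+n (∣m∣n⇒∣m+n (∣m⇒∣m*n u d∣u) (∣m⇒∣m*n v d∣u)) (∣m⇒∣m*n v d∣v))

  0<quadForm : ∀ {u} v → 0 < u → 0 < quadForm u v
  0<quadForm v (s≤s _) = s≤s z≤n

  PrimitiveFermatTriple : ℕ → ℕ → ℕ → ℕ → Set
  PrimitiveFermatTriple k p q r =
    0 < p × 0 < q × 0 < r × p ^ k + q ^ k ≡ r ^ k × Coprime p q × Coprime q r × Coprime p r

  fermat-product : ∀ k {p q r} → p ^ suc k + q ^ suc k ≡ r ^ suc k →
    p ^ suc k * q ^ suc k * (p ^ suc k + q ^ suc k) ≡ (p * q * r) ^ suc k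
  fermat-product k {p} {q} {r} fermat = begin
    p ^ suc k * q ^ suc k * (p ^ suc k + q ^ suc k) ≡⟨ cong (p ^ suc k * q ^ suc k *_) fermat ⟩
    p ^ suc k * q ^ suc k * r ^ suc k               ≡⟨ cong (_* r ^ suc k) (sym (^-distribʳ-* p q (suc k))) ⟩
    (p * q) ^ suc k * r ^ suc k                     ≡⟨ sym (^-distribʳ-* (p * q) r (suc k)) ⟩
    (p * q * r) ^ suc k                             ∎

  primitive-triple-of-factorisation : ∀ k {u v a} → 0 < u → 0 < v →
    u * v * (u + v) ≡ a ^ suc k → Coprime a (quadForm u v) →
    Σ ℕ λ p → Σ ℕ λ q → Σ ℕ λ r → a ≡ p * q * r × PrimitiveFermatTriple (suc k) p q r
  primitive-triple-of-factorisation k {u} {v} {a} 0<u 0<v uvw≡a^ a⊥Q =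
    p , q , r , a≡pqr ,
    0<base k (subst (0 <_) u≡p^ 0<u) , 0<base k (subst (0 <_) v≡q^ 0<v) ,
    0<base k (subst (0 <_) w≡r^ (<-≤-trans 0<u (m≤m+n u v))) ,
    fermat ,
    coprime-∣ (gcd[m,n]∣m u a) (gcd[m,n]∣m v a) u⊥v ,
    coprime-∣ (gcd[m,n]∣m v a) (gcd[m,n]∣m w a) v⊥w ,
    coprime-∣ (gcd[m,n]∣m u a) (gcd[m,n]∣m w a) u⊥w
    where
    w p q r : ℕ
    w = u + v
    p = gcd u a
    q = gcd v a
    r = gcd w a
    u⊥v : Coprime u v
    u⊥v = coprime-quadForm⇒coprime (subst (λ x → Coprime x (quadForm u v)) (sym uvw≡a^) (coprime-^ˡ (suc k) a⊥Q))
    u⊥w : Coprime u w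
    u⊥w = coprime-+ˡ u⊥v
    v⊥w : Coprime v w
    v⊥w = coprime-+ʳ u⊥v
    u≡p^ : u ≡ p ^ suc k
    u≡p^ = coprime-factor-of-power k (coprime-*ʳ u⊥v u⊥w) (trans (sym (*-assoc u v w)) uvw≡a^)
    v≡q^ : v ≡ q ^ suc k
    v≡q^ = coprime-factor-of-power k (coprime-*ʳ (Coprimality.sym u⊥v) v⊥w) (trans (rearrange u v w) uvw≡a^)
      where
      rearrange : ∀ u v w → v * (u * w) ≡ u * v * w
      rearrange = solve-∀
    w≡r^ : w ≡ r ^ suc k
    w≡r^ = coprime-factor-of-power k (Coprimality.sym (coprime-*ˡ u⊥w v⊥w)) (trans (*-comm w (u * v)) uvw≡a^)
    fermat : p ^ suc k + q ^ suc k ≡ r ^ suc k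
    fermat = trans (cong₂ _+_ (sym u≡p^) (sym v≡q^)) w≡r^
    a≡pqr : a ≡ p * q * r
    a≡pqr = ^-cancelʳ-≡ k (begin
      a ^ suc k                                       ≡⟨ sym uvw≡a^ ⟩
      u * v * (u + v)                                 ≡⟨ cong₂ (λ x y → x * y * (x + y)) u≡p^ v≡q^ ⟩
      p ^ suc k * q ^ suc k * (p ^ suc k + q ^ suc k) ≡⟨ fermat-product k {p} {q} {r} fermat ⟩
      (p * q * r) ^ suc k                             ∎)

  fermat⇒coprime-quadForm : ∀ k {p q r} → p ^ suc k + q ^ suc k ≡ r ^ suc k → Coprime p q →
    Coprime (p * q * r) (quadForm (p ^ suc k) (q ^ suc k))
  fermat⇒coprime-quadForm k {p} {q} {r} fermat p⊥q = coprime-^ˡ⁻¹ {p * q * r} {quadForm (p ^ suc k) (q ^ suc k)} k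
    (subst (λ m → Coprime m (quadForm (p ^ suc k) (q ^ suc k))) (fermat-product k {p} {q} {r} fermat)
      (coprime⇒coprime-quadForm {p ^ suc k} {q ^ suc k} (coprime-^ (suc k) (suc k) p⊥q)))

module RootTriples {c ℓ} (R : CommutativeRing c ℓ) where
  open CommutativeRing R
  open import Algebra.Properties.CommutativeSemigroup +-commutativeSemigroup
    using () renaming (xy∙z≈yz∙x to +-rotate; xy∙z≈zx∙y to +-rotate′)
  open import Algebra.Properties.CommutativeSemigroup *-commutativeSemigroup
    using () renaming (xy∙z≈yz∙x to *-rotate)

  -- Vieta's formulas: X³ + bX + k = (X - x)(X - y)(X - z).
  record IsRootTriple (b k x y z : Carrier) : Set ℓ where
    constructor vieta
    field
      sum≈0          : x + y + z ≈ 0#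
      linear-coeff   : b ≈ x * y + x * z + y * z
      constant-coeff : k ≈ - (x * y * z)

  IsRootTriple-rotate : ∀ {b k x y z} → IsRootTriple b k x y z → IsRootTriple b k y z x
  IsRootTriple-rotate {x = x} {y} {z} (vieta e₁ e₂ e₃) = vieta
    (trans (sym (+-rotate x y z)) e₁)
    (trans e₂ (trans (+-rotate′ (x * y) (x * z) (y * z)) (+-cong (+-cong refl (*-comm x y)) (*-comm x z))))
    (trans e₃ (-‿cong (*-rotate x y z)))

  IsRootTriple-unique : ∀ {b k b′ k′ x y z} → IsRootTriple b k x y z → IsRootTriple b′ k′ x y z → b ≈ b′ × k ≈ k′
  IsRootTriple-unique (vieta _ e₂ e₃) (vieta _ e₂′ e₃′) = trans e₂ (sym e₂′) , trans e₃ (sym e₃′)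

module IntegerRootTriples where
  open import Data.Nat.Base as ℕ using (ℕ; suc; s≤s; z≤n)
  open import Data.Integer.Base using (ℤ; +_; -[1+_]; +[1+_]; +0; _+_; _*_; -_; 0ℤ)
  open import Data.Integer.Properties
  open import Data.Integer.Tactic.RingSolver using (solve-∀)
  open import Data.Product using (Σ)
  open import Relation.Binary.PropositionalEquality
  open RootTriples +-*-commutativeRing public
  open FermatTriples using (quadForm)
  open ≡-Reasoning

  pos-quadForm : ∀ u v → + quadForm u v ≡ + u * + u + + u * + v + + v * + v
  pos-quadForm u v = begin
    + (u ℕ.* u ℕ.+ u ℕ.* v ℕ.+ v ℕ.* v)     ≡⟨ pos-+ (u ℕ.* u ℕ.+ u ℕ.* v) (v ℕ.* v) ⟩
    + (u ℕ.* u ℕ.+ u ℕ.* v) + + (v ℕ.* v)   ≡⟨ cong (_+ + (v ℕ.* v)) (pos-+ (u ℕ.* u) (u ℕ.* v)) ⟩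
    + (u ℕ.* u) + + (u ℕ.* v) + + (v ℕ.* v) ≡⟨ cong₂ _+_ (cong₂ _+_ (pos-* u u) (pos-* u v)) (pos-* v v) ⟩
    + u * + u + + u * + v + + v * + v       ∎

  pair-IsRootTriple : ∀ x y → IsRootTriple (- (x * x + x * y + y * y)) (x * y * (x + y)) x y (- (x + y))
  pair-IsRootTriple x y = vieta (e₁ x y) (e₂ x y) (e₃ x y)
    where
    e₁ : ∀ x y → x + y + - (x + y) ≡ 0ℤ
    e₁ = solve-∀
    e₂ : ∀ x y → - (x * x + x * y + y * y) ≡ x * y + x * - (x + y) + y * - (x + y)
    e₂ = solve-∀
    e₃ : ∀ x y → x * y * (x + y) ≡ - (x * y * - (x + y))
    e₃ = solve-∀

  positive-pair-IsRootTriple : ∀ u v →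
    IsRootTriple (- + quadForm u v) (+ (u ℕ.* v ℕ.* (u ℕ.+ v))) (+ u) (+ v) (- + (u ℕ.+ v))
  positive-pair-IsRootTriple u v =
    subst (λ w → IsRootTriple (- + quadForm u v) (+ (u ℕ.* v ℕ.* (u ℕ.+ v))) (+ u) (+ v) (- w)) (sym (pos-+ u v))
      (subst₂ (λ b k → IsRootTriple b k (+ u) (+ v) (- (+ u + + v)))
        (cong -_ (sym (pos-quadForm u v))) (sym pos-product) (pair-IsRootTriple (+ u) (+ v)))
    where
    pos-product : + (u ℕ.* v ℕ.* (u ℕ.+ v)) ≡ + u * + v * (+ u + + v)
    pos-product = begin
      + (u ℕ.* v ℕ.* (u ℕ.+ v))   ≡⟨ pos-* (u ℕ.* v) (u ℕ.+ v) ⟩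
      + (u ℕ.* v) * + (u ℕ.+ v)   ≡⟨ cong₂ _*_ (pos-* u v) (pos-+ u v) ⟩
      + u * + v * (+ u + + v)     ∎

  PositivePair : ℤ → ℕ → Set
  PositivePair b P = Σ ℕ λ u → Σ ℕ λ v →
    0 ℕ.< u × 0 ℕ.< v × b ≡ - + quadForm u v × u ℕ.* v ℕ.* (u ℕ.+ v) ≡ P

  positive-pair-of-IsRootTriple : ∀ {b P} u v w → IsRootTriple b (+ P) (+ suc u) (+ suc v) (- + suc w) →
    PositivePair b P
  positive-pair-of-IsRootTriple {b} {P} u v w roots@(vieta e₁ _ _)
    with +-injective (trans (pos-+ (suc u) (suc v)) (i-j≡0⇒i≡j (+ suc u + + suc v) (+ suc w) e₁))
  ... | refl with IsRootTriple-unique roots (positive-pair-IsRootTriple (suc u) (suc v))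
  ... | b≡ , P≡ = suc u , suc v , s≤s z≤n , s≤s z≤n , b≡ , +-injective (sym P≡)

  -- Two roots are positive: their product is -P < 0 and their sum is 0.
  IsRootTriple⇒positive-pair : ∀ {b P} x y z → 0 ℕ.< P → IsRootTriple b (+ P) x y z → PositivePair b P
  IsRootTriple⇒positive-pair +[1+ u ] +[1+ v ] -[1+ w ] _ roots = positive-pair-of-IsRootTriple u v w roots
  IsRootTriple⇒positive-pair +[1+ u ] -[1+ w ] +[1+ v ] _ roots =
    positive-pair-of-IsRootTriple v u w (IsRootTriple-rotate (IsRootTriple-rotate roots))
  IsRootTriple⇒positive-pair -[1+ w ] +[1+ u ] +[1+ v ] _ roots =
    positive-pair-of-IsRootTriple u v w (IsRootTriple-rotate roots)
  IsRootTriple⇒positive-pair +[1+ _ ] +[1+ _ ] +[1+ _ ] _ (vieta () _ _)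
  IsRootTriple⇒positive-pair -[1+ _ ] -[1+ _ ] -[1+ _ ] _ (vieta () _ _)
  IsRootTriple⇒positive-pair +[1+ _ ] -[1+ _ ] -[1+ _ ] _ (vieta _ _ ())
  IsRootTriple⇒positive-pair -[1+ _ ] +[1+ _ ] -[1+ _ ] _ (vieta _ _ ())
  IsRootTriple⇒positive-pair -[1+ _ ] -[1+ _ ] +[1+ _ ] _ (vieta _ _ ())
  IsRootTriple⇒positive-pair +0 y z (s≤s _) (vieta _ _ ())
  IsRootTriple⇒positive-pair x +0 z (s≤s _) (vieta _ _ e₃) with trans e₃ (cong (λ t → - (t * z)) (*-zeroʳ x))
  ... | ()
  IsRootTriple⇒positive-pair x y +0 (s≤s _) (vieta _ _ e₃) with trans e₃ (cong -_ (*-zeroʳ (x * y)))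
  ... | ()

module RationalRoots where
  open import Data.Nat.Base as ℕ using (suc)
  import Data.Nat.Properties as ℕ
  open import Data.Nat.Divisibility using (_∣_; ∣-refl; m∣m*n)
  open import Data.Nat.Coprimality as Coprimality using (Coprime)
  open import Data.Integer.Base as ℤ using (ℤ; +_; ∣_∣)
  import Data.Integer.Properties as ℤ
  open import Data.Integer.Tactic.RingSolver using (solve-∀)
  open import Data.Rational.Base using (ℚ; mkℚ; 0ℚ; toℚᵘ; ↥_; ↧_; _+_; _*_; -_)
  import Data.Rational.Properties as ℚ
  import Data.Rational.Unnormalised.Base as ℚᵘ
  open import Data.Rational.Unnormalised.Properties using (≃-trans; ≃-sym; ≃-refl; ≃-reflexive)
  open import Relation.Nullary.Decidable using (dec⇒maybe)
  open import Tactic.RingSolver.Core.AlmostCommutativeRing using (AlmostCommutativeRing; fromCommutativeRing)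
  import Tactic.RingSolver as Solver
  open import Relation.Binary.PropositionalEquality
  open PowersAndCoprimality using (coprime-*ˡ)

  ℚ-ring : AlmostCommutativeRing _ _
  ℚ-ring = fromCommutativeRing ℚ.+-*-commutativeRing (λ x → dec⇒maybe (0ℚ ℚ.≟ x))

  ℤtoℚ≡mkℚ : ∀ z → ℤtoℚ z ≡ mkℚ z 0 (Coprimality.sym (Coprimality.1-coprimeTo ∣ z ∣))
  ℤtoℚ≡mkℚ z = ℚ.↥p/↧p≡p (mkℚ z 0 _)

  ℤtoℚ-injective : ∀ {x y} → ℤtoℚ x ≡ ℤtoℚ y → x ≡ y
  ℤtoℚ-injective {x} {y} eq = trans (cong ↥_ (sym (ℤtoℚ≡mkℚ x))) (trans (cong ↥_ eq) (cong ↥_ (ℤtoℚ≡mkℚ y)))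

  ℤtoℚ-homo-+ : ∀ x y → ℤtoℚ (x ℤ.+ y) ≡ ℤtoℚ x + ℤtoℚ y
  ℤtoℚ-homo-+ x y = ℚ.toℚᵘ-injective (≃-trans (≃-reflexive (cong toℚᵘ (ℤtoℚ≡mkℚ (x ℤ.+ y))))
    (≃-trans homo (≃-sym (ℚ.toℚᵘ-homo-+ (ℤtoℚ x) (ℤtoℚ y)))))
    where
    homo : ℚᵘ.mkℚᵘ (x ℤ.+ y) 0 ℚᵘ.≃ toℚᵘ (ℤtoℚ x) ℚᵘ.+ toℚᵘ (ℤtoℚ y)
    homo rewrite ℤtoℚ≡mkℚ x | ℤtoℚ≡mkℚ y = ℚᵘ.*≡* (cross-multiply x y)
      where
      cross-multiply : ∀ x y → (x ℤ.+ y) ℤ.* ℤ.1ℤ ≡ (x ℤ.* ℤ.1ℤ ℤ.+ y ℤ.* ℤ.1ℤ) ℤ.* ℤ.1ℤ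
      cross-multiply = solve-∀

  ℤtoℚ-homo-* : ∀ x y → ℤtoℚ (x ℤ.* y) ≡ ℤtoℚ x * ℤtoℚ y
  ℤtoℚ-homo-* x y = ℚ.toℚᵘ-injective (≃-trans (≃-reflexive (cong toℚᵘ (ℤtoℚ≡mkℚ (x ℤ.* y))))
    (≃-trans homo (≃-sym (ℚ.toℚᵘ-homo-* (ℤtoℚ x) (ℤtoℚ y)))))
    where
    homo : ℚᵘ.mkℚᵘ (x ℤ.* y) 0 ℚᵘ.≃ toℚᵘ (ℤtoℚ x) ℚᵘ.* toℚᵘ (ℤtoℚ y)
    homo rewrite ℤtoℚ≡mkℚ x | ℤtoℚ≡mkℚ y = ≃-refl

  ℤtoℚ-homo‿- : ∀ x → ℤtoℚ (ℤ.- x) ≡ - ℤtoℚ x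
  ℤtoℚ-homo‿- x = ℚ.toℚᵘ-injective (≃-trans (≃-reflexive (cong toℚᵘ (ℤtoℚ≡mkℚ (ℤ.- x))))
    (≃-trans homo (≃-sym (ℚ.toℚᵘ-homo‿- (ℤtoℚ x)))))
    where
    homo : ℚᵘ.mkℚᵘ (ℤ.- x) 0 ℚᵘ.≃ ℚᵘ.- toℚᵘ (ℤtoℚ x)
    homo rewrite ℤtoℚ≡mkℚ x = ≃-refl

  ℤtoℚ-homo-*³ : ∀ x y z → ℤtoℚ (x ℤ.* y ℤ.* z) ≡ ℤtoℚ x * ℤtoℚ y * ℤtoℚ z
  ℤtoℚ-homo-*³ x y z = trans (ℤtoℚ-homo-* (x ℤ.* y) z) (cong (_* ℤtoℚ z) (ℤtoℚ-homo-* x y))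

  *-denominator : ∀ r → r * ℤtoℚ (↧ r) ≡ ℤtoℚ (↥ r)
  *-denominator r@(mkℚ n d _) = ℚ.toℚᵘ-injective (≃-trans (ℚ.toℚᵘ-homo-* r (ℤtoℚ (+ suc d)))
    (≃-trans homo (≃-reflexive (cong toℚᵘ (sym (ℤtoℚ≡mkℚ n))))))
    where
    homo : toℚᵘ r ℚᵘ.* toℚᵘ (ℤtoℚ (+ suc d)) ℚᵘ.≃ ℚᵘ.mkℚᵘ n 0
    homo rewrite ℤtoℚ≡mkℚ (+ suc d) =
      ℚᵘ.*≡* (trans (ℤ.*-identityʳ (n ℤ.* + suc d)) (cong (λ m → n ℤ.* + m) (sym (ℕ.*-identityʳ (suc d)))))

  -- Multiply r³ + br + k = 0 by (↧ r)³: the denominator divides the cube of the numerator.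
  clear-denominators : ∀ b k r → r * r * r + ℤtoℚ b * r + ℤtoℚ k ≡ 0ℚ →
    ↥ r ℤ.* ↥ r ℤ.* ↥ r ≡ ↧ r ℤ.* ℤ.- (b ℤ.* ↥ r ℤ.* ↧ r ℤ.+ k ℤ.* ↧ r ℤ.* ↧ r)
  clear-denominators b k r root = ℤtoℚ-injective (begin
    ℤtoℚ (n ℤ.* n ℤ.* n)                           ≡⟨ ℤtoℚ-homo-*³ n n n ⟩
    ℤtoℚ n * ℤtoℚ n * ℤtoℚ n                       ≡⟨ cong (λ m → m * m * m) (sym (*-denominator r)) ⟩
    (r * t) * (r * t) * (r * t)                    ≡⟨ scaled-root ⟩
    t * - (ℤtoℚ b * (r * t) * t + ℤtoℚ k * t * t)  ≡⟨ cong (λ m → t * - (ℤtoℚ b * m * t + ℤtoℚ k * t * t)) (*-denominator r) ⟩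
    t * - (ℤtoℚ b * ℤtoℚ n * t + ℤtoℚ k * t * t)   ≡⟨ sym ℤtoℚ-cofactor ⟩
    ℤtoℚ (d ℤ.* ℤ.- (b ℤ.* n ℤ.* d ℤ.+ k ℤ.* d ℤ.* d)) ∎)
    where
    open ≡-Reasoning
    n d : ℤ
    n = ↥ r
    d = ↧ r
    t : ℚ
    t = ℤtoℚ d
    expand : ∀ r t b k → (r * t) * (r * t) * (r * t) ≡ t * - (b * (r * t) * t + k * t * t) + (r * r * r + b * r + k) * (t * t * t)
    expand = Solver.solve-∀ ℚ-ring
    drop-zero : ∀ x y → x + 0ℚ * y ≡ x
    drop-zero = Solver.solve-∀ ℚ-ring
    scaled-root : (r * t) * (r * t) * (r * t) ≡ t * - (ℤtoℚ b * (r * t) * t + ℤtoℚ k * t * t)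
    scaled-root = trans (expand r t (ℤtoℚ b) (ℤtoℚ k))
      (trans (cong (λ e → t * - (ℤtoℚ b * (r * t) * t + ℤtoℚ k * t * t) + e * (t * t * t)) root)
        (drop-zero (t * - (ℤtoℚ b * (r * t) * t + ℤtoℚ k * t * t)) (t * t * t)))
    ℤtoℚ-cofactor : ℤtoℚ (d ℤ.* ℤ.- (b ℤ.* n ℤ.* d ℤ.+ k ℤ.* d ℤ.* d)) ≡ t * - (ℤtoℚ b * ℤtoℚ n * t + ℤtoℚ k * t * t)
    ℤtoℚ-cofactor = begin
      ℤtoℚ (d ℤ.* ℤ.- (b ℤ.* n ℤ.* d ℤ.+ k ℤ.* d ℤ.* d))  ≡⟨ ℤtoℚ-homo-* d (ℤ.- (b ℤ.* n ℤ.* d ℤ.+ k ℤ.* d ℤ.* d)) ⟩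
      t * ℤtoℚ (ℤ.- (b ℤ.* n ℤ.* d ℤ.+ k ℤ.* d ℤ.* d))   ≡⟨ cong (t *_) (ℤtoℚ-homo‿- (b ℤ.* n ℤ.* d ℤ.+ k ℤ.* d ℤ.* d)) ⟩
      t * - ℤtoℚ (b ℤ.* n ℤ.* d ℤ.+ k ℤ.* d ℤ.* d)        ≡⟨ cong (λ e → t * - e) (ℤtoℚ-homo-+ (b ℤ.* n ℤ.* d) (k ℤ.* d ℤ.* d)) ⟩
      t * - (ℤtoℚ (b ℤ.* n ℤ.* d) + ℤtoℚ (k ℤ.* d ℤ.* d)) ≡⟨ cong₂ (λ e f → t * - (e + f)) (ℤtoℚ-homo-*³ b n d) (ℤtoℚ-homo-*³ k d d) ⟩
      t * - (ℤtoℚ b * ℤtoℚ n * t + ℤtoℚ k * t * t)        ∎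

  integral-root : ∀ b k r → r * r * r + ℤtoℚ b * r + ℤtoℚ k ≡ 0ℚ → r ≡ ℤtoℚ (↥ r)
  integral-root b k r@(mkℚ n d n⊥d) root = trivial-denominator d n⊥d (ℕ.suc-injective (cube⊥d (d∣cube , ∣-refl)))
    where
    trivial-denominator : ∀ d .(n⊥d : Coprime ∣ n ∣ (suc d)) → d ≡ 0 → mkℚ n d n⊥d ≡ ℤtoℚ n
    trivial-denominator .0 _ refl = sym (ℤtoℚ≡mkℚ n)
    n⊥d′ : Coprime ∣ n ∣ (suc d)
    n⊥d′ = Coprimality.recompute n⊥d
    cube⊥d : Coprime (∣ n ∣ ℕ.* ∣ n ∣ ℕ.* ∣ n ∣) (suc d)
    cube⊥d = coprime-*ˡ (coprime-*ˡ n⊥d′ n⊥d′) n⊥d′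
    d∣cube : suc d ∣ ∣ n ∣ ℕ.* ∣ n ∣ ℕ.* ∣ n ∣
    d∣cube = subst (suc d ∣_) abs-cube (m∣m*n ∣ cofactor ∣)
      where
      cofactor : ℤ
      cofactor = ℤ.- (b ℤ.* n ℤ.* + suc d ℤ.+ k ℤ.* + suc d ℤ.* + suc d)
      abs-cube : suc d ℕ.* ∣ cofactor ∣ ≡ ∣ n ∣ ℕ.* ∣ n ∣ ℕ.* ∣ n ∣
      abs-cube = begin
        suc d ℕ.* ∣ cofactor ∣       ≡⟨ ℤ.abs-* (+ suc d) cofactor ⟨
        ∣ + suc d ℤ.* cofactor ∣     ≡⟨ cong ∣_∣ (clear-denominators b k r root) ⟨
        ∣ n ℤ.* n ℤ.* n ∣            ≡⟨ ℤ.abs-* (n ℤ.* n) n ⟩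
        ∣ n ℤ.* n ∣ ℕ.* ∣ n ∣        ≡⟨ cong (ℕ._* ∣ n ∣) (ℤ.abs-* n n) ⟩
        ∣ n ∣ ℕ.* ∣ n ∣ ℕ.* ∣ n ∣    ∎
        where open ≡-Reasoning

module SplittingCubics where
  open import Data.Nat.Base as ℕ using (suc)
  import Data.Nat.Properties as ℕ
  import Data.Integer.Base as ℤ
  import Data.Integer.Properties as ℤ
  open import Data.Rational.Base using (ℚ; 0ℚ; 1ℚ; ↥_; _+_; _*_; -_)
  import Data.Rational.Properties as ℚ
  open import Data.List.Base using ([]; _∷_; length)
  open import Data.List.Properties using (length-map)
  open import Data.Product using (∃-syntax)
  import Tactic.RingSolver as Solver
  open import Relation.Binary.PropositionalEquality
  open RationalRoots
  module ℤRoots = RootTriples ℤ.+-*-commutativeRing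
  module ℚRoots = RootTriples ℚ.+-*-commutativeRing
  open ℚRoots using (IsRootTriple; vieta; IsRootTriple-rotate)

  IsRootTriple⇒root : ∀ {b k x y z} → IsRootTriple b k x y z → x * x * x + b * x + k ≡ 0ℚ
  IsRootTriple⇒root {b} {k} {x} {y} {z} (vieta e₁ e₂ e₃) = begin
    x * x * x + b * x + k                                   ≡⟨ cong₂ (λ b k → x * x * x + b * x + k) e₂ e₃ ⟩
    x * x * x + (x * y + x * z + y * z) * x + - (x * y * z) ≡⟨ factor x y z ⟩
    x * x * (x + y + z)                                     ≡⟨ cong (x * x *_) e₁ ⟩
    x * x * 0ℚ                                              ≡⟨ ℚ.*-zeroʳ (x * x) ⟩
    0ℚ                                                      ∎
    where
    open ≡-Reasoning
    factor : ∀ x y z → x * x * x + (x * y + x * z + y * z) * x + - (x * y * z) ≡ x * x * (x + y + z)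
    factor = Solver.solve-∀ ℚ-ring

  ℤtoℚ-sum : ∀ x y z → ℤtoℚ (x ℤ.+ y ℤ.+ z) ≡ ℤtoℚ x + ℤtoℚ y + ℤtoℚ z
  ℤtoℚ-sum x y z = trans (ℤtoℚ-homo-+ (x ℤ.+ y) z) (cong (_+ ℤtoℚ z) (ℤtoℚ-homo-+ x y))

  ℤtoℚ-pair-sum : ∀ x y z →
    ℤtoℚ (x ℤ.* y ℤ.+ x ℤ.* z ℤ.+ y ℤ.* z) ≡ ℤtoℚ x * ℤtoℚ y + ℤtoℚ x * ℤtoℚ z + ℤtoℚ y * ℤtoℚ z
  ℤtoℚ-pair-sum x y z = trans (ℤtoℚ-sum (x ℤ.* y) (x ℤ.* z) (y ℤ.* z))
    (cong₂ _+_ (cong₂ _+_ (ℤtoℚ-homo-* x y) (ℤtoℚ-homo-* x z)) (ℤtoℚ-homo-* y z))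

  ℤtoℚ-neg-product : ∀ x y z → ℤtoℚ (ℤ.- (x ℤ.* y ℤ.* z)) ≡ - (ℤtoℚ x * ℤtoℚ y * ℤtoℚ z)
  ℤtoℚ-neg-product x y z = trans (ℤtoℚ-homo‿- (x ℤ.* y ℤ.* z)) (cong -_ (ℤtoℚ-homo-*³ x y z))

  ℤtoℚ-IsRootTriple : ∀ {b k x y z} → ℤRoots.IsRootTriple b k x y z →
    IsRootTriple (ℤtoℚ b) (ℤtoℚ k) (ℤtoℚ x) (ℤtoℚ y) (ℤtoℚ z)
  ℤtoℚ-IsRootTriple {x = x} {y} {z} (ℤRoots.vieta e₁ e₂ e₃) = vieta
    (trans (sym (ℤtoℚ-sum x y z)) (cong ℤtoℚ e₁))
    (trans (cong ℤtoℚ e₂) (ℤtoℚ-pair-sum x y z))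
    (trans (cong ℤtoℚ e₃) (ℤtoℚ-neg-product x y z))

  ℤtoℚ-IsRootTriple⁻¹ : ∀ {b k x y z} → IsRootTriple (ℤtoℚ b) (ℤtoℚ k) (ℤtoℚ x) (ℤtoℚ y) (ℤtoℚ z) →
    ℤRoots.IsRootTriple b k x y z
  ℤtoℚ-IsRootTriple⁻¹ {x = x} {y} {z} (vieta e₁ e₂ e₃) = ℤRoots.vieta
    (ℤtoℚ-injective (trans (ℤtoℚ-sum x y z) e₁))
    (ℤtoℚ-injective (trans e₂ (sym (ℤtoℚ-pair-sum x y z))))
    (ℤtoℚ-injective (trans e₃ (sym (ℤtoℚ-neg-product x y z))))

  length-+ₚ : ∀ p q → length (p +ₚ q) ≡ length p ℕ.⊔ length q
  length-+ₚ []      q       = refl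
  length-+ₚ (_ ∷ p) []      = refl
  length-+ₚ (_ ∷ p) (_ ∷ q) = cong suc (length-+ₚ p q)

  length-prodLinear : ∀ rs → length (prodLinear rs) ≡ suc (length rs)
  length-prodLinear []       = refl
  length-prodLinear (r ∷ rs) = length-linear-*ₚ (prodLinear rs) (length-prodLinear rs)
    where
    length-linear-*ₚ : ∀ p {n} → length p ≡ suc n → length (linear r *ₚ p) ≡ suc (suc n)
    length-linear-*ₚ (a ∷ p) refl = cong suc (begin
      length (scaleₚ (- r) p +ₚ (1ℚ * a + 0ℚ ∷ (scaleₚ 1ℚ p +ₚ [])))
        ≡⟨ length-+ₚ (scaleₚ (- r) p) _ ⟩
      length (scaleₚ (- r) p) ℕ.⊔ suc (length (scaleₚ 1ℚ p +ₚ []))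
        ≡⟨ cong₂ (λ m n → m ℕ.⊔ suc n) (length-map _ p) (trans (length-+ₚ (scaleₚ 1ℚ p) []) (trans (ℕ.⊔-identityʳ _) (length-map _ p))) ⟩
      length p ℕ.⊔ suc (length p)
        ≡⟨ ℕ.m≤n⇒m⊔n≡n (ℕ.n≤1+n (length p)) ⟩
      suc (length p) ∎)
      where open ≡-Reasoning

  expand-three : ∀ c x y z → scaleₚ c (prodLinear (x ∷ y ∷ z ∷ [])) ≡
    - (c * (x * y * z)) ∷ c * (x * y + x * z + y * z) ∷ - (c * (x + y + z)) ∷ c ∷ []
  expand-three c x y z =
    cong₂ _∷_ (Solver.solve (c ∷ x ∷ y ∷ z ∷ []) ℚ-ring) (
    cong₂ _∷_ (Solver.solve (c ∷ x ∷ y ∷ z ∷ []) ℚ-ring) (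
    cong₂ _∷_ (Solver.solve (c ∷ x ∷ y ∷ z ∷ []) ℚ-ring) (
    cong₂ _∷_ (Solver.solve (c ∷ []) ℚ-ring) refl)))

  ∷⁴-injective : ∀ {a₀ a₁ a₂ a₃ b₀ b₁ b₂ b₃ : ℚ} → a₀ ∷ a₁ ∷ a₂ ∷ a₃ ∷ [] ≡ b₀ ∷ b₁ ∷ b₂ ∷ b₃ ∷ [] →
    a₀ ≡ b₀ × a₁ ≡ b₁ × a₂ ≡ b₂ × a₃ ≡ b₃
  ∷⁴-injective refl = refl , refl , refl , refl

  coefficients⇒IsRootTriple : ∀ {b k c x y z} →
    ℤtoℚ k ≡ - (c * (x * y * z)) × ℤtoℚ b ≡ c * (x * y + x * z + y * z) × 0ℚ ≡ - (c * (x + y + z)) × 1ℚ ≡ c →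
    IsRootTriple (ℤtoℚ b) (ℤtoℚ k) x y z
  coefficients⇒IsRootTriple {x = x} {y} {z} (k≡ , b≡ , 0≡ , refl) = vieta
    (trans (double-negation (x + y + z)) (cong -_ (sym 0≡)))
    (trans b≡ (ℚ.*-identityˡ _))
    (trans k≡ (cong -_ (ℚ.*-identityˡ _)))
    where
    double-negation : ∀ s → s ≡ - (- (1ℚ * s))
    double-negation = Solver.solve-∀ ℚ-ring

  SplitsOverℚ-cubic⇒IsRootTriple : ∀ {b k} → SplitsOverℚ (cubic b k) →
    ∃[ x ] ∃[ y ] ∃[ z ] IsRootTriple (ℤtoℚ b) (ℤtoℚ k) x y z
  SplitsOverℚ-cubic⇒IsRootTriple {b} {k} (c , rs , eq) = three-roots rs (ℕ.suc-injective length≡) eq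
    where
    length≡ : 4 ≡ suc (length rs)
    length≡ = trans (cong length eq) (trans (length-map _ (prodLinear rs)) (length-prodLinear rs))
    three-roots : ∀ rs → 3 ≡ length rs → cubic b k ≡ scaleₚ c (prodLinear rs) →
      ∃[ x ] ∃[ y ] ∃[ z ] IsRootTriple (ℤtoℚ b) (ℤtoℚ k) x y z
    three-roots (x ∷ y ∷ z ∷ []) _ eq =
      x , y , z , coefficients⇒IsRootTriple {b} {k} (∷⁴-injective (trans eq (expand-three c x y z)))

  IsRootTriple⇒SplitsOverℚ-cubic : ∀ {b k x y z} → IsRootTriple (ℤtoℚ b) (ℤtoℚ k) x y z → SplitsOverℚ (cubic b k)
  IsRootTriple⇒SplitsOverℚ-cubic {x = x} {y} {z} (vieta e₁ e₂ e₃) =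
    1ℚ , x ∷ y ∷ z ∷ [] ,
    trans (cong₂ _∷_ (trans e₃ (cong -_ (sym (ℚ.*-identityˡ _))))
          (cong₂ _∷_ (trans e₂ (sym (ℚ.*-identityˡ _)))
          (cong₂ _∷_ (cong (λ s → - (1ℚ * s)) (sym e₁)) refl)))
      (sym (expand-three 1ℚ x y z))

  SplitsOverℚ-cubic⇒integer-roots : ∀ {b k} → SplitsOverℚ (cubic b k) →
    ∃[ x ] ∃[ y ] ∃[ z ] ℤRoots.IsRootTriple b k x y z
  SplitsOverℚ-cubic⇒integer-roots {b} {k} split = integral (SplitsOverℚ-cubic⇒IsRootTriple {b} {k} split)
    where
    reflect : ∀ {x y z X Y Z} → x ≡ ℤtoℚ X → y ≡ ℤtoℚ Y → z ≡ ℤtoℚ Z →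
      IsRootTriple (ℤtoℚ b) (ℤtoℚ k) x y z → ℤRoots.IsRootTriple b k X Y Z
    reflect refl refl refl = ℤtoℚ-IsRootTriple⁻¹
    integral : (∃[ x ] ∃[ y ] ∃[ z ] IsRootTriple (ℤtoℚ b) (ℤtoℚ k) x y z) →
      ∃[ x ] ∃[ y ] ∃[ z ] ℤRoots.IsRootTriple b k x y z
    integral (x , y , z , roots) = ↥ x , ↥ y , ↥ z , reflect
      (integral-root b k x (IsRootTriple⇒root roots))
      (integral-root b k y (IsRootTriple⇒root (IsRootTriple-rotate roots)))
      (integral-root b k z (IsRootTriple⇒root (IsRootTriple-rotate (IsRootTriple-rotate roots))))
      roots

open import Data.Nat as ℕ using (ℕ)
open import Data.Nat.Coprimality using (Coprime)
open import Data.Integer as ℤ using (ℤ; +_)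
open import Data.Integer.GCD using (gcd)
open import Data.Product using (Σ; _×_; ∃-syntax)
open import Relation.Binary.PropositionalEquality using (_≡_; _≢_)

open import Data.Nat.Base using (zero; suc; s≤s)
import Data.Nat.Coprimality as Coprimality
import Data.Nat.GCD as GCD
import Data.Integer.Properties as ℤ
open import Relation.Binary.PropositionalEquality using (refl; sym; trans; cong; subst; module ≡-Reasoning)
open PowersAndCoprimality using (0<^)
open FermatTriples
open IntegerRootTriples using (IsRootTriple; IsRootTriple⇒positive-pair; positive-pair-IsRootTriple)
open SplittingCubics using (SplitsOverℚ-cubic⇒integer-roots; IsRootTriple⇒SplitsOverℚ-cubic; ℤtoℚ-IsRootTriple)

pos-^ : ∀ m k → (+ m) ℤ.^ k ≡ + (m ℕ.^ k)
pos-^ m zero    = refl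
pos-^ m (suc k) = trans (cong (+ m ℤ.*_) (pos-^ m k)) (sym (ℤ.pos-* m (m ℕ.^ k)))

gcd[+m,-n]≡+gcd : ∀ m n → gcd (+ m) (ℤ.- + n) ≡ + GCD.gcd m n
gcd[+m,-n]≡+gcd m n = cong (λ i → + GCD.gcd m i) (ℤ.∣-i∣≡∣i∣ (+ n))

FermatSolution : ℕ → ℤ → Set
FermatSolution n a = Σ ℕ λ p → Σ ℕ λ q → Σ ℕ λ r →
  0 ℕ.< p × 0 ℕ.< q × 0 ℕ.< r × a ≡ + (p ℕ.* q ℕ.* r) ×
  p ℕ.^ n ℕ.+ q ℕ.^ n ≡ r ℕ.^ n × Coprime p q × Coprime q r × Coprime p r

integer-roots⇒fermat : ∀ k {A b x y z} → 0 ℕ.< A → gcd (+ A) b ≡ + 1 →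
  IsRootTriple b (+ (A ℕ.^ suc k)) x y z → FermatSolution (suc k) (+ A)
integer-roots⇒fermat k {A} {b} {x} {y} {z} 0<A A⊥b roots =
  from-pair (IsRootTriple⇒positive-pair x y z (0<^ (suc k) 0<A) roots)
  where
  A⊥Q : ∀ {Q} → gcd (+ A) (ℤ.- + Q) ≡ + 1 → Coprime A Q
  A⊥Q {Q} A⊥-Q = Coprimality.gcd≡1⇒coprime (ℤ.+-injective (trans (sym (gcd[+m,-n]≡+gcd A Q)) A⊥-Q))
  from-pair : IntegerRootTriples.PositivePair b (A ℕ.^ suc k) → FermatSolution (suc k) (+ A)
  from-pair (u , v , 0<u , 0<v , b≡ , uvw≡A^)
    with primitive-triple-of-factorisation k 0<u 0<v uvw≡A^ (A⊥Q (subst (λ c → gcd (+ A) c ≡ + 1) b≡ A⊥b))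
  ... | p , q , r , A≡pqr , 0<p , 0<q , 0<r , rest = p , q , r , 0<p , 0<q , 0<r , cong +_ A≡pqr , rest

splitting⇒fermat : ∀ k (a b : ℤ) → gcd a b ≡ + 1 → ℤ.0ℤ ℤ.< a → b ≢ ℤ.0ℤ →
  SplitsOverℚ (cubic b (a ℤ.^ suc k)) → FermatSolution (suc k) a
splitting⇒fermat k (+ A) b A⊥b (ℤ.+<+ 0<A) _ split = from-roots (SplitsOverℚ-cubic⇒integer-roots {b} {(+ A) ℤ.^ suc k} split)
  where
  from-roots : ∃[ x ] ∃[ y ] ∃[ z ] IsRootTriple b ((+ A) ℤ.^ suc k) x y z → FermatSolution (suc k) (+ A)
  from-roots (x , y , z , roots) =
    integer-roots⇒fermat k 0<A A⊥b (subst (λ c → IsRootTriple b c x y z) (pos-^ A (suc k)) roots)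

fermat⇒splitting : ∀ k (p q r : ℕ) → 0 ℕ.< p → 0 ℕ.< q → 0 ℕ.< r →
  p ℕ.^ suc k ℕ.+ q ℕ.^ suc k ≡ r ℕ.^ suc k →
  Coprime p q → Coprime q r → Coprime p r →
  Σ ℤ λ a → Σ ℤ λ b →
    a ≡ + (p ℕ.* q ℕ.* r) × b ≢ ℤ.0ℤ × gcd a b ≡ + 1 ×
    SplitsOverℚ (cubic b (a ℤ.^ suc k))
fermat⇒splitting k p q r 0<p _ _ fermat p⊥q _ _ =
  + (p ℕ.* q ℕ.* r) , ℤ.- + quadForm P Q , refl , b≢0 , gcd≡1 ,
  IsRootTriple⇒SplitsOverℚ-cubic {ℤ.- + quadForm P Q} {(+ (p ℕ.* q ℕ.* r)) ℤ.^ suc k} (ℤtoℚ-IsRootTriple roots)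
  where
  P Q : ℕ
  P = p ℕ.^ suc k
  Q = q ℕ.^ suc k
  roots : IsRootTriple (ℤ.- + quadForm P Q) ((+ (p ℕ.* q ℕ.* r)) ℤ.^ suc k) (+ P) (+ Q) (ℤ.- + (P ℕ.+ Q))
  roots = subst (λ c → IsRootTriple (ℤ.- + quadForm P Q) c (+ P) (+ Q) (ℤ.- + (P ℕ.+ Q)))
            (trans (cong +_ (fermat-product k {p} {q} {r} fermat)) (sym (pos-^ (p ℕ.* q ℕ.* r) (suc k))))
            (positive-pair-IsRootTriple P Q)
  b≢0 : ℤ.- + quadForm P Q ≢ ℤ.0ℤ
  b≢0 = neg-positive≢0 (0<quadForm Q (0<^ (suc k) 0<p))
    where
    neg-positive≢0 : ∀ {n} → 0 ℕ.< n → ℤ.- + n ≢ ℤ.0ℤ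
    neg-positive≢0 (s≤s _) ()
  gcd≡1 : gcd (+ (p ℕ.* q ℕ.* r)) (ℤ.- + quadForm P Q) ≡ + 1
  gcd≡1 = trans (gcd[+m,-n]≡+gcd (p ℕ.* q ℕ.* r) (quadForm P Q))
                (cong +_ (Coprimality.coprime⇒gcd≡1 (fermat⇒coprime-quadForm k {p} {q} {r} fermat p⊥q)))

theorem1 : (n : ℕ) → 0 ℕ.< n →
    ((a b : ℤ) → gcd a b ≡ + 1 → ℤ.0ℤ ℤ.< a → b ≢ ℤ.0ℤ →
      SplitsOverℚ (cubic b (a ℤ.^ n)) →
      Σ ℕ λ p → Σ ℕ λ q → Σ ℕ λ r →
        0 ℕ.< p × 0 ℕ.< q × 0 ℕ.< r × a ≡ + (p ℕ.* q ℕ.* r) ×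
        p ℕ.^ n ℕ.+ q ℕ.^ n ≡ r ℕ.^ n ×
        Coprime p q × Coprime q r × Coprime p r)
    ×
    ((p q r : ℕ) → 0 ℕ.< p → 0 ℕ.< q → 0 ℕ.< r →
      p ℕ.^ n ℕ.+ q ℕ.^ n ≡ r ℕ.^ n →
      Coprime p q → Coprime q r → Coprime p r →
      Σ ℤ λ a → Σ ℤ λ b →
        a ≡ + (p ℕ.* q ℕ.* r) × b ≢ ℤ.0ℤ × gcd a b ≡ + 1 ×
        SplitsOverℚ (cubic b (a ℤ.^ n)))
theorem1 (suc k) _ = splitting⇒fermat k , fermat⇒splitting k
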